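{- Let $m\geq 1$ and let $k_1,\ldots,k_m\in\mathbb{Z}$ be arbitrary integers. Then there exist nonnegative integers $n$ and $t$ such that for all $1\leq \ell\leq m$, \[k_\ell=s_2(n+\ell t)-s_2(n).\]
   Context: For a nonnegative integer $n$ with binary expansion $n=\varepsilon_\nu 2^\nu+\cdots+\varepsilon_0 2^0$ ($\varepsilon_i\in\{0,1\}$), the binary sum-of-digits function is $s_2(n)=\varepsilon_\nu+\cdots+\varepsilon_0$, i.e. the number of nonzero binary digits of $n$. -}

module Defs where

open import Data.Nat using (ℕ; zero; suc; _+_; _%_; _/_)

-- Binary sum-of-digits s₂(n): number of 1s in the binary expansion of n.
-- Computed with a fuel argument; fuel n always suffices since ⌊n/2⌋ < n
-- for n ≥ 1 and the number of halving steps is ≤ n.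
s₂-fuel : ℕ → ℕ → ℕ
s₂-fuel zero    n = 0
s₂-fuel (suc f) zero = 0
s₂-fuel (suc f) (suc n) = (suc n % 2) + s₂-fuel f (suc n / 2)

s₂ : ℕ → ℕ
s₂ n = s₂-fuel n n

-- Write Δ(n,t)(ℓ) for s₂(n + ℓt) − s₂(n).  Two digit facts drive everything:
--   * concatenation: s₂(a + 2^N b) = s₂ a + s₂ b whenever a < 2^N;
--   * complement:    s₂ y + s₂ z = N whenever y + z + 1 = 2^N.
-- Concatenation makes Δ additive under "joining" two pairs (n,t): if the second
-- pair is shifted above every digit the first one uses, their Δ's add up.
-- Complement and concatenation compute Δ explicitly for two families of pairs,
-- the ascent (r, 2^N − 1) and the descent (2^M − r − 1, 1).  Their join has
-- Δ(ℓ) = s₂ ℓ for ℓ ≤ r, while Δ(r+1) = N + 1 + s₂ r − M can be any integer.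
-- Hence a vector prescribed on 1…r extends to one prescribed on 1…r+1
-- (subtract s₂ ℓ below, realise the rest by induction, then join the block),
-- and the theorem is the case where r is the length of the vector.
module Submission where

open import Defs
open import Data.Nat using (ℕ; suc; _+_; _*_)
open import Data.Integer using (ℤ; +_; _-_)
open import Data.Fin using (Fin; toℕ)
open import Data.Product using (∃; ∃-syntax)
open import Relation.Binary.PropositionalEquality using (_≡_)

open import Data.Nat using (zero; _∸_; _^_; _≤_; _<_; z≤n; s≤s; _%_; _/_)
open import Data.Nat.Properties
open import Data.Nat.DivMod
open import Data.Nat.Divisibility using (n∣m*n)
open import Data.Nat.Tactic.RingSolver using (solve-∀)
import Data.Integer as ℤ
import Data.Integer.Properties as ℤ
import Data.Integer.Tactic.RingSolver as ℤ-Solver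
open import Data.Fin using (zero; suc)
open import Data.Fin.Properties using (toℕ<n)
open import Data.Product using (_×_; _,_; proj₁; proj₂)
open import Data.Sum using (inj₁; inj₂)
open import Data.Empty using (⊥-elim)
open import Relation.Nullary using (¬_)
open import Relation.Binary.PropositionalEquality
  using (refl; sym; trans; cong; cong₂; subst; module ≡-Reasoning)

half≤pred : ∀ n → suc n / 2 ≤ n
half≤pred n = <⇒≤pred (m/n<m (suc n) 2 (s≤s (s≤s z≤n)))

s₂-fuel-irrelevant : ∀ f g n → n ≤ f → n ≤ g → s₂-fuel f n ≡ s₂-fuel g n
s₂-fuel-irrelevant f       g       zero    _       _       = fuel-zero f g
  where
  fuel-zero : ∀ f g → s₂-fuel f 0 ≡ s₂-fuel g 0
  fuel-zero zero    zero    = refl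
  fuel-zero zero    (suc g) = refl
  fuel-zero (suc f) zero    = refl
  fuel-zero (suc f) (suc g) = refl
s₂-fuel-irrelevant (suc f) (suc g) (suc n) (s≤s n≤f) (s≤s n≤g) =
  cong (λ s → suc n % 2 + s)
    (s₂-fuel-irrelevant f g (suc n / 2) (≤-trans (half≤pred n) n≤f) (≤-trans (half≤pred n) n≤g))

s₂-step : ∀ n → s₂ n ≡ n % 2 + s₂ (n / 2)
s₂-step zero    = refl
s₂-step (suc n) =
  cong (λ s → suc n % 2 + s) (s₂-fuel-irrelevant n (suc n / 2) (suc n / 2) (half≤pred n) ≤-refl)

s₂-digit : ∀ b a → b < 2 → s₂ (b + a * 2) ≡ b + s₂ a
s₂-digit b a b<2 = trans (s₂-step (b + a * 2)) (cong₂ _+_ last-digit (cong s₂ rest))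
  where
  last-digit : (b + a * 2) % 2 ≡ b
  last-digit = trans ([m+kn]%n≡m%n b a 2) (m<n⇒m%n≡m b<2)
  rest : (b + a * 2) / 2 ≡ a
  rest = trans (+-distrib-/-∣ʳ b (n∣m*n a)) (cong₂ _+_ (m<n⇒m/n≡0 b<2) (m*n/n≡m a 2))

s₂-concat : ∀ N a b → a < 2 ^ N → s₂ (a + 2 ^ N * b) ≡ s₂ a + s₂ b
s₂-concat zero    zero    b _         = cong s₂ (+-identityʳ b)
s₂-concat zero    (suc a) b (s≤s ())
s₂-concat (suc N) a       b a<2^[1+N] = begin
    s₂ (a + 2 ^ suc N * b)                  ≡⟨ cong s₂ split-off-digit ⟩
    s₂ (a % 2 + (a / 2 + 2 ^ N * b) * 2)    ≡⟨ s₂-digit (a % 2) (a / 2 + 2 ^ N * b) (m%n<n a 2) ⟩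
    a % 2 + s₂ (a / 2 + 2 ^ N * b)          ≡⟨ cong (λ s → a % 2 + s) (s₂-concat N (a / 2) b half<2^N) ⟩
    a % 2 + (s₂ (a / 2) + s₂ b)             ≡⟨ sym (+-assoc (a % 2) _ _) ⟩
    a % 2 + s₂ (a / 2) + s₂ b               ≡⟨ cong (_+ s₂ b) (sym (s₂-step a)) ⟩
    s₂ a + s₂ b                             ∎
  where
  open ≡-Reasoning
  half<2^N : a / 2 < 2 ^ N
  half<2^N = m<n*o⇒m/o<n (subst (a <_) (*-comm 2 (2 ^ N)) a<2^[1+N])
  regroup : ∀ d h K b → d + h * 2 + 2 * K * b ≡ d + (h + K * b) * 2
  regroup = solve-∀
  split-off-digit : a + 2 ^ suc N * b ≡ a % 2 + (a / 2 + 2 ^ N * b) * 2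
  split-off-digit = trans (cong (_+ 2 ^ suc N * b) (m≡m%n+[m/n]*n a 2)) (regroup (a % 2) (a / 2) (2 ^ N) b)

odd≢even : ∀ u v → ¬ (1 + u * 2 ≡ v * 2)
odd≢even u v eq with trans (sym ([m+kn]%n≡m%n 1 u 2)) (trans (cong (_% 2) eq) (m*n%n≡0 v 2))
... | ()

-- The carry analysis behind complements: two digits b, c plus one form an even
-- number together with 2u only if exactly one digit is 1, and then the carry
-- passes to the higher digits.
complementary-digits : ∀ b c u v → b < 2 → c < 2 →
  b + c + 1 + u * 2 ≡ v * 2 → b + c ≡ 1 × u + 1 ≡ v
complementary-digits 0 0 u v _ _ eq = ⊥-elim (odd≢even u v eq)
complementary-digits 0 1 u v _ _ eq = refl , trans (+-comm u 1) (*-cancelʳ-≡ (suc u) v 2 eq)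
complementary-digits 1 0 u v _ _ eq = refl , trans (+-comm u 1) (*-cancelʳ-≡ (suc u) v 2 eq)
complementary-digits 1 1 u v _ _ eq = ⊥-elim (odd≢even (suc u) v eq)
complementary-digits (suc (suc _)) _ _ _ (s≤s (s≤s ())) _ _
complementary-digits _ (suc (suc _)) _ _ _ (s≤s (s≤s ())) _

-- Complements: if y + z + 1 = 2^N then the binary digits of y and z are
-- complementary in the N lowest positions, so together they have N ones.
s₂-complement : ∀ N y z → y + z + 1 ≡ 2 ^ N → s₂ y + s₂ z ≡ N
s₂-complement zero y z eq
  with m+n≡0⇒m≡0 y (+-cancelʳ-≡ 1 (y + z) 0 eq) | m+n≡0⇒n≡0 y (+-cancelʳ-≡ 1 (y + z) 0 eq)
... | refl | refl = refl
s₂-complement (suc N) y z eq = begin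
    s₂ y + s₂ z                                     ≡⟨ cong₂ _+_ (s₂-step y) (s₂-step z) ⟩
    (y % 2 + s₂ (y / 2)) + (z % 2 + s₂ (z / 2))     ≡⟨ interchange (y % 2) (s₂ (y / 2)) (z % 2) (s₂ (z / 2)) ⟩
    (y % 2 + z % 2) + (s₂ (y / 2) + s₂ (z / 2))     ≡⟨ cong₂ _+_ digits-sum (s₂-complement N (y / 2) (z / 2) carry) ⟩
    suc N                                           ∎
  where
  open ≡-Reasoning
  interchange : ∀ a b c d → a + b + (c + d) ≡ a + c + (b + d)
  interchange = solve-∀
  regroup : ∀ b y' c z' → b + y' * 2 + (c + z' * 2) + 1 ≡ b + c + 1 + (y' + z') * 2
  regroup = solve-∀
  split : y % 2 + z % 2 + 1 + (y / 2 + z / 2) * 2 ≡ 2 ^ N * 2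
  split = begin
    y % 2 + z % 2 + 1 + (y / 2 + z / 2) * 2                   ≡⟨ sym (regroup (y % 2) (y / 2) (z % 2) (z / 2)) ⟩
    y % 2 + y / 2 * 2 + (z % 2 + z / 2 * 2) + 1               ≡⟨ cong₂ (λ a b → a + b + 1) (sym (m≡m%n+[m/n]*n y 2)) (sym (m≡m%n+[m/n]*n z 2)) ⟩
    y + z + 1                                                 ≡⟨ trans eq (*-comm 2 (2 ^ N)) ⟩
    2 ^ N * 2                                                 ∎
  digits : y % 2 + z % 2 ≡ 1 × y / 2 + z / 2 + 1 ≡ 2 ^ N
  digits = complementary-digits (y % 2) (z % 2) (y / 2 + z / 2) (2 ^ N) (m%n<n y 2) (m%n<n z 2) split
  digits-sum : y % 2 + z % 2 ≡ 1
  digits-sum = proj₁ digits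
  carry : y / 2 + z / 2 + 1 ≡ 2 ^ N
  carry = proj₂ digits

-- 2^N − 1 is the predecessor of 2^N (truncated subtraction does not truncate).
pred-2^N : ∀ N → suc (2 ^ N ∸ 1) ≡ 2 ^ N
pred-2^N N = m+[n∸m]≡n (m^n>0 2 N)

s₂-ones : ∀ N → s₂ (2 ^ N ∸ 1) ≡ N
s₂-ones N = trans (sym (+-identityʳ _)) (s₂-complement N (2 ^ N ∸ 1) 0 ones+0+1≡2^N)
  where
  ones+0+1≡2^N : 2 ^ N ∸ 1 + 0 + 1 ≡ 2 ^ N
  ones+0+1≡2^N = trans (trans (+-comm (2 ^ N ∸ 1 + 0) 1) (cong suc (+-identityʳ _))) (pred-2^N N)

n<2^n : ∀ n → n < 2 ^ n
n<2^n zero    = s≤s z≤n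
n<2^n (suc n) = +-mono-≤ (m^n>0 2 n) (subst (n <_) (sym (+-identityʳ (2 ^ n))) (n<2^n n))

r<2^[r+k] : ∀ r k → r < 2 ^ (r + k)
r<2^[r+k] r k = <-≤-trans (n<2^n r) (^-monoʳ-≤ 2 (m≤m+n r k))

Progression : Set
Progression = ℕ × ℕ

Δ : Progression → ℕ → ℤ
Δ (n , t) ℓ = + s₂ (n + ℓ * t) - + s₂ n

pos-sum-diff : ∀ a b c d → + (a + b) - + (c + d) ≡ (+ a - + c) ℤ.+ (+ b - + d)
pos-sum-diff a b c d = trans (cong₂ _-_ (ℤ.pos-+ a b) (ℤ.pos-+ c d)) (regroup (+ a) (+ b) (+ c) (+ d))
  where
  regroup : ∀ a b c d → (a ℤ.+ b) - (c ℤ.+ d) ≡ (a - c) ℤ.+ (b - d)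
  regroup = ℤ-Solver.solve-∀

diff-swap : ∀ a b c d → a + b ≡ c + d → + a - + c ≡ + d - + b
diff-swap a b c d eq = begin
    + a - + c                       ≡⟨ add-and-remove (+ a) (+ b) (+ c) ⟩
    (+ a ℤ.+ + b) - + b - + c       ≡⟨ cong (λ s → s - + b - + c) same-sum ⟩
    (+ c ℤ.+ + d) - + b - + c       ≡⟨ cancel (+ b) (+ c) (+ d) ⟩
    + d - + b                       ∎
  where
  open ≡-Reasoning
  same-sum : + a ℤ.+ + b ≡ + c ℤ.+ + d
  same-sum = trans (sym (ℤ.pos-+ a b)) (trans (cong +_ eq) (ℤ.pos-+ c d))
  add-and-remove : ∀ a b c → a - c ≡ (a ℤ.+ b) - b - c
  add-and-remove = ℤ-Solver.solve-∀
  cancel : ∀ b c d → (c ℤ.+ d) - b - c ≡ d - b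
  cancel = ℤ-Solver.solve-∀

Δ-concat : ∀ P n₁ t₁ n₂ t₂ ℓ → n₁ + ℓ * t₁ < 2 ^ P →
  Δ (n₁ + 2 ^ P * n₂ , t₁ + 2 ^ P * t₂) ℓ ≡ Δ (n₁ , t₁) ℓ ℤ.+ Δ (n₂ , t₂) ℓ
Δ-concat P n₁ t₁ n₂ t₂ ℓ below = begin
    + s₂ (n₁ + B * n₂ + ℓ * (t₁ + B * t₂)) - + s₂ (n₁ + B * n₂)
      ≡⟨ cong₂ _-_ (cong +_ (trans (cong s₂ (regroup n₁ t₁ n₂ t₂ ℓ B)) (s₂-concat P (n₁ + ℓ * t₁) (n₂ + ℓ * t₂) below)))
                   (cong +_ (s₂-concat P n₁ n₂ (≤-<-trans (m≤m+n n₁ (ℓ * t₁)) below))) ⟩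
    + (s₂ (n₁ + ℓ * t₁) + s₂ (n₂ + ℓ * t₂)) - + (s₂ n₁ + s₂ n₂)
      ≡⟨ pos-sum-diff (s₂ (n₁ + ℓ * t₁)) (s₂ (n₂ + ℓ * t₂)) (s₂ n₁) (s₂ n₂) ⟩
    Δ (n₁ , t₁) ℓ ℤ.+ Δ (n₂ , t₂) ℓ ∎
  where
  open ≡-Reasoning
  B : ℕ
  B = 2 ^ P
  regroup : ∀ n₁ t₁ n₂ t₂ ℓ B → n₁ + B * n₂ + ℓ * (t₁ + B * t₂) ≡ n₁ + ℓ * t₁ + B * (n₂ + ℓ * t₂)
  regroup = solve-∀

-- Joining two progressions for positions up to L: shift the second one above
-- all digits the first one uses at positions ℓ ≤ L.
join : ℕ → Progression → Progression → Progression
join L (n₁ , t₁) (n₂ , t₂) = n₁ + 2 ^ (n₁ + L * t₁) * n₂ , t₁ + 2 ^ (n₁ + L * t₁) * t₂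

Δ-join : ∀ L p q ℓ → ℓ ≤ L → Δ (join L p q) ℓ ≡ Δ p ℓ ℤ.+ Δ q ℓ
Δ-join L (n₁ , t₁) (n₂ , t₂) ℓ ℓ≤L = Δ-concat (n₁ + L * t₁) n₁ t₁ n₂ t₂ ℓ
  (≤-<-trans (+-monoʳ-≤ n₁ (*-monoˡ-≤ t₁ ℓ≤L)) (n<2^n (n₁ + L * t₁)))

-- The ascent (r, 2^N − 1): at ℓ ≤ r the digits of r − ℓ and ℓ separate, and at
-- ℓ = r + 1 the value is 2^N − 1 followed by r, i.e. exactly N new ones.
ascent : ℕ → ℕ → Progression
ascent r N = r , 2 ^ N ∸ 1

Δ-ascent-low : ∀ r N ℓ → r < 2 ^ N → ℓ ≤ r →
  Δ (ascent r N) ℓ ≡ + (s₂ (r ∸ ℓ) + s₂ ℓ) - + s₂ r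
Δ-ascent-low r N ℓ r<2^N ℓ≤r =
  cong (λ s → + s - + s₂ r)
    (trans (cong s₂ separate) (s₂-concat N (r ∸ ℓ) ℓ (≤-<-trans (m∸n≤m r ℓ) r<2^N)))
  where
  regroup : ∀ d ℓ Q → d + ℓ + ℓ * Q ≡ d + suc Q * ℓ
  regroup = solve-∀
  separate : r + ℓ * (2 ^ N ∸ 1) ≡ r ∸ ℓ + 2 ^ N * ℓ
  separate = trans (cong (λ s → s + ℓ * (2 ^ N ∸ 1)) (sym (m∸n+n≡m ℓ≤r)))
    (trans (regroup (r ∸ ℓ) ℓ (2 ^ N ∸ 1)) (cong (λ s → r ∸ ℓ + s * ℓ) (pred-2^N N)))

Δ-ascent-top : ∀ r N → Δ (ascent r N) (suc r) ≡ + N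
Δ-ascent-top r N = begin
    + s₂ (r + suc r * (2 ^ N ∸ 1)) - + s₂ r     ≡⟨ cong (λ s → + s - + s₂ r) (trans (cong s₂ separate) digits) ⟩
    + (N + s₂ r) - + s₂ r                       ≡⟨ diff-swap (N + s₂ r) 0 (s₂ r) N (trans (+-identityʳ (N + s₂ r)) (+-comm N (s₂ r))) ⟩
    + N - + 0                                   ≡⟨ ℤ.+-identityʳ (+ N) ⟩
    + N                                         ∎
  where
  open ≡-Reasoning
  regroup : ∀ r Q → r + suc r * Q ≡ Q + suc Q * r
  regroup = solve-∀
  separate : r + suc r * (2 ^ N ∸ 1) ≡ 2 ^ N ∸ 1 + 2 ^ N * r
  separate = trans (regroup r (2 ^ N ∸ 1)) (cong (λ s → 2 ^ N ∸ 1 + s * r) (pred-2^N N))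
  digits : s₂ (2 ^ N ∸ 1 + 2 ^ N * r) ≡ N + s₂ r
  digits = trans (s₂-concat N (2 ^ N ∸ 1) r (≤-reflexive (pred-2^N N))) (cong (_+ s₂ r) (s₂-ones N))

-- The descent (2^M − r − 1, 1): for ℓ ≤ r the number 2^M − r − 1 + ℓ is the
-- complement of r − ℓ below 2^M, and at ℓ = r + 1 it reaches 2^M itself.
descent : ℕ → ℕ → Progression
descent r M = 2 ^ M ∸ suc r , 1

descent-complement : ∀ r M ℓ → r < 2 ^ M → ℓ ≤ r →
  s₂ (2 ^ M ∸ suc r + ℓ * 1) + s₂ (r ∸ ℓ) ≡ M
descent-complement r M ℓ r<2^M ℓ≤r = s₂-complement M (2 ^ M ∸ suc r + ℓ * 1) (r ∸ ℓ) fills-2^M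
  where
  regroup : ∀ z ℓ d → z + ℓ * 1 + d + 1 ≡ z + suc (ℓ + d)
  regroup = solve-∀
  fills-2^M : 2 ^ M ∸ suc r + ℓ * 1 + (r ∸ ℓ) + 1 ≡ 2 ^ M
  fills-2^M = trans (regroup (2 ^ M ∸ suc r) ℓ (r ∸ ℓ))
    (trans (cong (λ s → 2 ^ M ∸ suc r + suc s) (m+[n∸m]≡n ℓ≤r)) (m∸n+n≡m r<2^M))

descent-start : ∀ r M → r < 2 ^ M → s₂ (2 ^ M ∸ suc r) + s₂ r ≡ M
descent-start r M r<2^M =
  trans (cong (λ s → s₂ s + s₂ r) (sym (+-identityʳ (2 ^ M ∸ suc r)))) (descent-complement r M 0 r<2^M z≤n)

Δ-descent-low : ∀ r M ℓ → r < 2 ^ M → ℓ ≤ r →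
  Δ (descent r M) ℓ ≡ + s₂ r - + s₂ (r ∸ ℓ)
Δ-descent-low r M ℓ r<2^M ℓ≤r =
  diff-swap (s₂ (2 ^ M ∸ suc r + ℓ * 1)) (s₂ (r ∸ ℓ)) (s₂ (2 ^ M ∸ suc r)) (s₂ r)
  (trans (descent-complement r M ℓ r<2^M ℓ≤r) (sym (descent-start r M r<2^M)))

-- At the top the descent lands on 2^M, so Δ = 1 − (M − s₂ r).
Δ-descent-top : ∀ r M → r < 2 ^ M → Δ (descent r M) (suc r) ≡ + suc (s₂ r) - + M
Δ-descent-top r M r<2^M = begin
    + s₂ (2 ^ M ∸ suc r + suc r * 1) - + s₂ (2 ^ M ∸ suc r)   ≡⟨ cong (λ s → + s - + s₂ (2 ^ M ∸ suc r)) reaches-2^M ⟩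
    + 1 - + s₂ (2 ^ M ∸ suc r)                                ≡⟨ diff-swap 1 M (s₂ (2 ^ M ∸ suc r)) (suc (s₂ r)) one-more ⟩
    + suc (s₂ r) - + M                                        ∎
  where
  open ≡-Reasoning
  power-of-two : 2 ^ M ∸ suc r + suc r * 1 ≡ 0 + 2 ^ M * 1
  power-of-two = trans (cong (λ s → 2 ^ M ∸ suc r + s) (*-identityʳ (suc r)))
    (trans (m∸n+n≡m r<2^M) (sym (*-identityʳ (2 ^ M))))
  reaches-2^M : s₂ (2 ^ M ∸ suc r + suc r * 1) ≡ 1
  reaches-2^M = trans (cong s₂ power-of-two) (s₂-concat M 0 1 (m^n>0 2 M))
  one-more : 1 + M ≡ s₂ (2 ^ M ∸ suc r) + suc (s₂ r)
  one-more = sym (trans (+-suc _ (s₂ r)) (cong suc (descent-start r M r<2^M)))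

-- The block: ascent joined with descent.  Below r + 1 it has difference vector
-- ℓ ↦ s₂ ℓ, independent of N and M; at r + 1 it takes the value N + 1 + s₂ r − M.
block : ℕ → ℕ → ℕ → Progression
block r N M = join (suc r) (ascent r N) (descent r M)

Δ-block-low : ∀ r N M ℓ → r < 2 ^ N → r < 2 ^ M → ℓ ≤ r → Δ (block r N M) ℓ ≡ + s₂ ℓ
Δ-block-low r N M ℓ r<2^N r<2^M ℓ≤r = begin
    Δ (block r N M) ℓ
      ≡⟨ Δ-join (suc r) (ascent r N) (descent r M) ℓ (≤-trans ℓ≤r (n≤1+n r)) ⟩
    Δ (ascent r N) ℓ ℤ.+ Δ (descent r M) ℓ
      ≡⟨ cong₂ ℤ._+_ (Δ-ascent-low r N ℓ r<2^N ℓ≤r) (Δ-descent-low r M ℓ r<2^M ℓ≤r) ⟩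
    (+ (s₂ (r ∸ ℓ) + s₂ ℓ) - + s₂ r) ℤ.+ (+ s₂ r - + s₂ (r ∸ ℓ))
      ≡⟨ cong (λ s → (s - + s₂ r) ℤ.+ (+ s₂ r - + s₂ (r ∸ ℓ))) (ℤ.pos-+ (s₂ (r ∸ ℓ)) (s₂ ℓ)) ⟩
    ((+ s₂ (r ∸ ℓ) ℤ.+ + s₂ ℓ) - + s₂ r) ℤ.+ (+ s₂ r - + s₂ (r ∸ ℓ))
      ≡⟨ telescope (+ s₂ (r ∸ ℓ)) (+ s₂ ℓ) (+ s₂ r) ⟩
    + s₂ ℓ ∎
  where
  open ≡-Reasoning
  telescope : ∀ a b c → ((a ℤ.+ b) - c) ℤ.+ (c - a) ≡ b
  telescope = ℤ-Solver.solve-∀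

Δ-block-top : ∀ r N M → r < 2 ^ M → Δ (block r N M) (suc r) ≡ + N ℤ.+ (+ suc (s₂ r) - + M)
Δ-block-top r N M r<2^M =
  trans (Δ-join (suc r) (ascent r N) (descent r M) (suc r) ≤-refl)
        (cong₂ ℤ._+_ (Δ-ascent-top r N) (Δ-descent-top r M r<2^M))

ℤ-as-difference : ∀ w → ∃[ p ] ∃[ q ] (w ≡ + p - + q)
ℤ-as-difference (+ p)     = p , 0 , sym (ℤ.+-identityʳ (+ p))
ℤ-as-difference ℤ.-[1+ q ] = 0 , suc q , sym (ℤ.+-identityˡ ℤ.-[1+ q ])

block-top-surjective : ∀ r w →
  ∃[ N ] ∃[ M ] (r < 2 ^ N × r < 2 ^ M × + N ℤ.+ (+ suc (s₂ r) - + M) ≡ w)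
block-top-surjective r w with ℤ-as-difference w
... | p , q , refl =
  r + p , r + (suc (s₂ r) + q) , r<2^[r+k] r p , r<2^[r+k] r (suc (s₂ r) + q) , top-value
  where
  top-value : + (r + p) ℤ.+ (+ suc (s₂ r) - + (r + (suc (s₂ r) + q))) ≡ + p - + q
  top-value = trans
    (cong₂ (λ a b → a ℤ.+ (+ suc (s₂ r) - b))
           (ℤ.pos-+ r p)
           (trans (ℤ.pos-+ r (suc (s₂ r) + q)) (cong (λ s → + r ℤ.+ s) (ℤ.pos-+ (suc (s₂ r)) q))))
    (cancel (+ r) (+ p) (+ suc (s₂ r)) (+ q))
    where
    cancel : ∀ r p s q → (r ℤ.+ p) ℤ.+ (s - (r ℤ.+ (s ℤ.+ q))) ≡ p - q
    cancel = ℤ-Solver.solve-∀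

-- Main induction: every v is realised on positions 1 … r.  For r + 1, realise
-- v ℓ − s₂ ℓ on 1 … r, then join the block whose top value corrects position r + 1.
realise : ∀ r (v : ℕ → ℤ) → ∃[ P ] (∀ ℓ → 1 ≤ ℓ → ℓ ≤ r → Δ P ℓ ≡ v ℓ)
realise zero    v = (0 , 0) , λ { zero () _ ; (suc _) _ () }
realise (suc r) v with realise r (λ ℓ → v ℓ - + s₂ ℓ)
... | P₁ , P₁-realises with block-top-surjective r (v (suc r) - Δ P₁ (suc r))
... | N , M , r<2^N , r<2^M , top≡ = join (suc r) P₁ (block r N M) , realises
  where
  add-back : ∀ a b → (a - b) ℤ.+ b ≡ a
  add-back = ℤ-Solver.solve-∀
  correct : ∀ a b → b ℤ.+ (a - b) ≡ a
  correct = ℤ-Solver.solve-∀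
  realises : ∀ ℓ → 1 ≤ ℓ → ℓ ≤ suc r → Δ (join (suc r) P₁ (block r N M)) ℓ ≡ v ℓ
  realises ℓ 1≤ℓ ℓ≤1+r with m≤n⇒m<n∨m≡n ℓ≤1+r
  ... | inj₁ (s≤s ℓ≤r) = trans (Δ-join (suc r) P₁ (block r N M) ℓ ℓ≤1+r)
    (trans (cong₂ ℤ._+_ (P₁-realises ℓ 1≤ℓ ℓ≤r) (Δ-block-low r N M ℓ r<2^N r<2^M ℓ≤r))
           (add-back (v ℓ) (+ s₂ ℓ)))
  ... | inj₂ refl = trans (Δ-join (suc r) P₁ (block r N M) (suc r) ≤-refl)
    (trans (cong (λ s → Δ P₁ (suc r) ℤ.+ s) (trans (Δ-block-top r N M r<2^M) top≡))
           (correct (v (suc r)) (Δ P₁ (suc r))))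

-- A vector indexed by Fin r, read as a function of the positions 1 … r and
-- extended by zero elsewhere.
extend : ∀ {r} → (Fin r → ℤ) → ℕ → ℤ
extend {zero}  k _             = + 0
extend {suc r} k zero          = + 0
extend {suc r} k (suc zero)    = k zero
extend {suc r} k (suc (suc ℓ)) = extend (λ i → k (suc i)) (suc ℓ)

extend-lookup : ∀ {r} (k : Fin r → ℤ) i → extend k (suc (toℕ i)) ≡ k i
extend-lookup k zero    = refl
extend-lookup k (suc i) = extend-lookup (λ j → k (suc j)) i

theorem1 : (m : ℕ) → (k : Fin (suc m) → ℤ) →
    ∃[ n ] ∃[ t ] (∀ (i : Fin (suc m)) →
      k i ≡ (+ s₂ (n + suc (toℕ i) * t)) - (+ s₂ n))
theorem1 m k with realise (suc m) (extend k)
... | (n , t) , realises = n , t , λ i →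
  sym (trans (realises (suc (toℕ i)) (s≤s z≤n) (toℕ<n i)) (extend-lookup k i))
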